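{- Let $G=(V,E)$ be a graph with costs $c:V\to\mathbb{R}_{\ge0}$ and run the primal-dual algorithm with reverse-delete described in the context. Then for each iteration $i$, $|W_i|\le|A_i|$, where $W_i=Y-X_{i-1}$.
   Context: $\Gamma(v)$ is the neighbor set of $v$ and $\Gamma^+(v)=\Gamma(v)\cup\{v\}$; a set $D$ is dominating if $D\cap\Gamma^+(v)\neq\emptyset$ for all $v$. Primal-dual algorithm: start with $X_0=\{v:c(v)=0\}$ and $y(v)=0$ for all $v$. In iteration $i=1,2,\dots$: let $A_i=\{v\in V: X_{i-1}\cap\Gamma^+(v)=\emptyset\}$. If $A_i=\emptyset$, stop and set $X=X_{i-1}$. Otherwise increase all $y(a)$, $a\in A_i$, uniformly until for some vertex $v$ the constraint $\sum_{u\in\Gamma^+(v)}y(u)\le c(v)$ becomes tight; let $X_i$ be $X_{i-1}$ together with all vertices whose constraint is tight. Reverse-delete: set $Y=X$ and consider the vertices of $X$ in the reverse of the order in which they were added to $X$ (a fixed linear order consistent with the iterations); for the current vertex $v$, if $Y-v$ is a dominating set, remove $v$ from $Y$.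
   Formalization: The costs c and the dual values y take values in the rationals instead of the reals. -}

module Defs where

open import Data.Nat using (ℕ; zero; suc; _<_)
open import Data.Bool using (Bool; true; false; if_then_else_; not)
open import Data.Fin using (Fin; zero; suc; toℕ)
open import Data.Fin.Subset using (Subset; _∈_; _∉_; _∩_; _∪_; _─_; _-_; ⁅_⁆; Nonempty; Empty)
open import Data.Fin.Subset.Properties using (nonempty?)
open import Data.Fin.Properties using (all?)
open import Data.Vec using (tabulate; lookup)
open import Data.List using (List; []; _∷_; length; reverse)
import Data.List as L
open import Data.List.Membership.Propositional using () renaming (_∈_ to _∈ₗ_)
open import Data.List.Relation.Unary.Unique.Propositional using (Unique)
open import Data.Rational using (ℚ; 0ℚ; _+_; _≤_)
open import Data.Product using (Σ; _×_; ∃-syntax)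
open import Data.Sum using (_⊎_)
open import Function using (_∘_; _⇔_)
open import Relation.Nullary using (¬_; does)
open import Relation.Binary.PropositionalEquality using (_≡_)

record Graph (n : ℕ) : Set where
  field
    Γ        : Fin n → Subset n
    symmetric : ∀ {u v} → u ∈ Γ v → v ∈ Γ u
    loopless : ∀ v → v ∉ Γ v

module _ {n : ℕ} (G : Graph n) where
  open Graph G

  Γ⁺ : Fin n → Subset n
  Γ⁺ v = Γ v ∪ ⁅ v ⁆

  Dominating : Subset n → Set
  Dominating D = ∀ v → Nonempty (D ∩ Γ⁺ v)

  -- A(X) = { v : X ∩ Γ⁺(v) = ∅ }  (so A_i = Aset X_{i-1})
  Aset : Subset n → Subset n
  Aset X = tabulate (λ v → not (does (nonempty? (X ∩ Γ⁺ v))))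

  load : (Fin n → ℚ) → Fin n → ℚ
  load y v = sumℚ (λ u → if lookup (Γ⁺ v) u then y u else 0ℚ)
    where
    sumℚ : ∀ {m} → (Fin m → ℚ) → ℚ
    sumℚ {zero}  f = 0ℚ
    sumℚ {suc m} f = f zero + sumℚ (f ∘ suc)

  -- X i is X_i, y i is the dual y after iteration i, δ i the uniform increase
  -- in iteration i; the algorithm performs iterations 1..T (A_i ≠ ∅) and stops
  -- at iteration T+1 (A_{T+1} = ∅), returning X = X T.
  record PrimalDualRun (c : Fin n → ℚ) : Set where
    field
      T : ℕ
      X : ℕ → Subset n
      y : ℕ → Fin n → ℚ
      δ : ℕ → ℚ
      X₀    : ∀ v → (v ∈ X 0) ⇔ (c v ≡ 0ℚ)
      y₀    : ∀ v → y 0 v ≡ 0ℚ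
      active   : ∀ i → i < T → Nonempty (Aset (X i))
      δ-nonneg : ∀ i → i < T → 0ℚ ≤ δ (suc i)
      y-step   : ∀ i → i < T → ∀ a →
                   y (suc i) a ≡ (if lookup (Aset (X i)) a then y i a + δ (suc i) else y i a)
      feasible : ∀ i → i < T → ∀ v → load (y (suc i)) v ≤ c v
      -- the increase stops exactly when some constraint becomes tight
      tightens : ∀ i → i < T → ∃[ v ] (v ∉ X i × load (y (suc i)) v ≡ c v)
      X-step   : ∀ i → i < T → ∀ v →
                   (v ∈ X (suc i)) ⇔ (v ∈ X i ⊎ load (y (suc i)) v ≡ c v)
      stop : Empty (Aset (X T))

  record AdditionOrder {c : Fin n → ℚ} (R : PrimalDualRun c) : Set where
    open PrimalDualRun R
    field
      ord      : List (Fin n)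
      unique   : Unique ord
      covers   : ∀ v → (v ∈ X T) ⇔ (v ∈ₗ ord)
      consistent : ∀ (j k : Fin (length ord)) → toℕ j < toℕ k →
                     ∀ i → L.lookup ord k ∈ X i → L.lookup ord j ∈ X i

  reverseDelete : Subset n → List (Fin n) → Subset n
  reverseDelete Y []       = Y
  reverseDelete Y (v ∷ vs) =
    reverseDelete (if does (all? (λ w → nonempty? ((Y - v) ∩ Γ⁺ w))) then Y - v else Y) vs

  outputY : {c : Fin n → ℚ} (R : PrimalDualRun c) → AdditionOrder R → Subset n
  outputY R O = reverseDelete (PrimalDualRun.X R (PrimalDualRun.T R))
                              (reverse (AdditionOrder.ord O))

-- Each v ∈ Y ─ X_i survived reverse-delete, so when v was examined, deleting it
-- from the current set Z would have left some vertex w undominated: w is a private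
-- neighbour of v with respect to Z ⊇ Y. The vertices examined before v were added
-- to X no earlier than v, so (as v ∉ X_i) none of them lies in X_i; all other
-- vertices of X_i are still in Z. Hence X_i ∩ Γ⁺(w) = ∅, i.e. w ∈ A(X_i). Since Y
-- is dominating, v is the only vertex of Y dominating w, so v ↦ w is injective.
module Submission where

open import Defs
open import Data.Nat using (ℕ; suc; _≤_; _<_; _≤′_; ≤′-refl; ≤′-step; z≤n; s≤s)
open import Data.Nat.Properties using (≤-refl; ≤-trans; ≤⇒≤′; <⇒≤)
open import Data.Fin using (Fin; toℕ; zero; suc)
open import Data.Fin.Properties using (all?; ¬∀⟶∃¬; suc-injective; _≟_)
open import Data.Fin.Subset
  using (Subset; _─_; ∣_∣; _∈_; _∉_; _∩_; _-_; ⁅_⁆; Empty; _⊆_; inside; outside)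
open import Data.Fin.Subset.Properties
  using (nonempty?; x∈p∧x≢y⇒x∈p-y; x∈p∩q⁺; x∈p∩q⁻; p─q⊆p; x∈⁅x⁆; x∈p⇒∣p-x∣<∣p∣)
open import Data.Rational using (ℚ; 0ℚ)
import Data.Rational as Q
open import Data.Vec using ([]; _∷_; here; there)
open import Data.Vec.Properties using (lookup∘tabulate; lookup⇒[]=)
open import Data.Bool using (true; not; if_then_else_)
open import Data.List using (List; []; _∷_; _++_; [_]; _∷ʳ_; reverse; length)
import Data.List as List
open import Data.List.Properties using (reverse-involutive; reverse-++; unfold-reverse; ++-assoc)
open import Data.List.Membership.Propositional using () renaming (_∈_ to _∈ₗ_; _∉_ to _∉ₗ_)
open import Data.List.Membership.Propositional.Properties using (∈-∃++)
open import Data.List.Membership.DecPropositional using (_∈?_)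
open import Data.List.Relation.Unary.Any using (index; here; there)
open import Data.List.Relation.Unary.Any.Properties
  using (lookup-index) renaming (reverse⁺ to ∈-reverse⁺)
open import Data.Product using (_×_; _,_; ∃; ∃₂)
open import Data.Sum using (inj₁)
open import Function using (_∘_; id; Equivalence)
open import Relation.Nullary using (¬_; Dec; does; yes; no; contradiction)
open import Relation.Binary.PropositionalEquality
  using (_≡_; refl; sym; trans; cong; subst; _≢_; module ≡-Reasoning)

x∈p─q⇒x∉q : ∀ {n} {p q : Subset n} {x} → x ∈ p ─ q → x ∉ q
x∈p─q⇒x∉q {p = inside ∷ p}  {outside ∷ q} here       ()
x∈p─q⇒x∉q {p = _ ∷ p}       {_ ∷ q}       (there x∈) (there x∈q) = x∈p─q⇒x∉q x∈ x∈q

injection⇒∣p∣≤∣q∣ : ∀ {m n} {p : Subset m} {q : Subset n} (f : ∀ {x} → x ∈ p → Fin n) →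
                    (∀ {x} (x∈p : x ∈ p) → f x∈p ∈ q) →
                    (∀ {x y} (x∈p : x ∈ p) (y∈p : y ∈ p) → f x∈p ≡ f y∈p → x ≡ y) →
                    ∣ p ∣ ≤ ∣ q ∣
injection⇒∣p∣≤∣q∣ {p = []} f f∈q f-inj = z≤n
injection⇒∣p∣≤∣q∣ {p = outside ∷ p} f f∈q f-inj =
  injection⇒∣p∣≤∣q∣ (f ∘ there) (f∈q ∘ there)
    (λ x∈p y∈p eq → suc-injective (f-inj (there x∈p) (there y∈p) eq))
injection⇒∣p∣≤∣q∣ {p = inside ∷ p} {q} f f∈q f-inj =
  ≤-trans (s≤s (injection⇒∣p∣≤∣q∣ (f ∘ there) f∈q-f₀ f-inj-there)) (x∈p⇒∣p-x∣<∣p∣ (f∈q here))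
  where
  f-inj-there : ∀ {x y} (x∈p : x ∈ p) (y∈p : y ∈ p) → f (there x∈p) ≡ f (there y∈p) → x ≡ y
  f-inj-there x∈p y∈p eq = suc-injective (f-inj (there x∈p) (there y∈p) eq)

  f∈q-f₀ : ∀ {x} (x∈p : x ∈ p) → f (there x∈p) ∈ q - f here
  f∈q-f₀ x∈p = x∈p∧x≢y⇒x∈p-y (f∈q (there x∈p)) (λ eq → contradiction (f-inj (there x∈p) here eq) λ ())

IndexSorted : ∀ {A : Set} → (A → A → Set) → List A → Set
IndexSorted R xs =
  ∀ (j k : Fin (length xs)) → toℕ j < toℕ k → R (List.lookup xs j) (List.lookup xs k)

indexSorted-++-∷ : ∀ {A : Set} {R : A → A → Set} xs {v ys u} →
                   IndexSorted R (xs ++ v ∷ ys) → u ∈ₗ ys → R v u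
indexSorted-++-∷ {R = R} [] {v} sorted u∈ys =
  subst (R v) (sym (lookup-index u∈ys)) (sorted zero (suc (index u∈ys)) (s≤s z≤n))
indexSorted-++-∷ {R = R} (x ∷ xs) sorted u∈ys =
  indexSorted-++-∷ {R = R} xs (λ j k j<k → sorted (suc j) (suc k) (s≤s j<k)) u∈ys

reverse≡++-∷ : ∀ {A : Set} (xs ys : List A) {v zs} →
               reverse xs ≡ ys ++ v ∷ zs → xs ≡ reverse zs ++ v ∷ reverse ys
reverse≡++-∷ xs ys {v} {zs} eq = begin
  xs                              ≡⟨ sym (reverse-involutive xs) ⟩
  reverse (reverse xs)            ≡⟨ cong reverse eq ⟩
  reverse (ys ++ v ∷ zs)          ≡⟨ reverse-++ ys (v ∷ zs) ⟩
  reverse (v ∷ zs) ++ reverse ys  ≡⟨ cong (_++ reverse ys) (unfold-reverse v zs) ⟩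
  (reverse zs ∷ʳ v) ++ reverse ys ≡⟨ ++-assoc (reverse zs) [ v ] (reverse ys) ⟩
  reverse zs ++ v ∷ reverse ys    ∎
  where open ≡-Reasoning

module _ {n : ℕ} (G : Graph n) where

  PrivateNeighbour : Subset n → Fin n → Fin n → Set
  PrivateNeighbour Y v w = Empty ((Y - v) ∩ Γ⁺ G w)

  privateNeighbour-dominator : ∀ {Y v w z} → PrivateNeighbour Y v w → z ∈ Y → z ∈ Γ⁺ G w → z ≡ v
  privateNeighbour-dominator {v = v} {z = z} private-w z∈Y z∈Γ⁺w with z ≟ v
  ... | yes z≡v = z≡v
  ... | no  z≢v = contradiction (z , x∈p∩q⁺ (x∈p∧x≢y⇒x∈p-y z∈Y z≢v , z∈Γ⁺w)) private-w

  privateNeighbour-unique : ∀ {D Y Y′ v v′ w} → Dominating G D → D ⊆ Y → D ⊆ Y′ →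
                            PrivateNeighbour Y v w → PrivateNeighbour Y′ v′ w → v ≡ v′
  privateNeighbour-unique {D} {w = w} D-dom D⊆Y D⊆Y′ private-w private′-w
    with z , z∈D∩Γ⁺w ← D-dom w
    with z∈D , z∈Γ⁺w ← x∈p∩q⁻ D (Γ⁺ G w) z∈D∩Γ⁺w
    = trans (sym (privateNeighbour-dominator private-w (D⊆Y z∈D) z∈Γ⁺w))
            (privateNeighbour-dominator private′-w (D⊆Y′ z∈D) z∈Γ⁺w)

  ∈Aset⁺ : ∀ {X v} → Empty (X ∩ Γ⁺ G v) → v ∈ Aset G X
  ∈Aset⁺ {X} {v} empty = lookup⇒[]= v _ (trans (lookup∘tabulate _ v) not-nonempty)
    where
    not-nonempty : not (does (nonempty? (X ∩ Γ⁺ G v))) ≡ true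
    not-nonempty with nonempty? (X ∩ Γ⁺ G v)
    ... | yes nonempty = contradiction nonempty empty
    ... | no  _        = refl

  Aset-empty⇒dominating : ∀ {X} → Empty (Aset G X) → Dominating G X
  Aset-empty⇒dominating {X} A-empty v with nonempty? (X ∩ Γ⁺ G v)
  ... | yes nonempty = nonempty
  ... | no  empty    = contradiction (v , ∈Aset⁺ empty) A-empty

  removable? : ∀ Y v → Dec (Dominating G (Y - v))
  removable? Y v = all? (λ w → nonempty? ((Y - v) ∩ Γ⁺ G w))

  deleteStep : Subset n → Fin n → Subset n
  deleteStep Y v = if does (removable? Y v) then Y - v else Y

  data DeleteStep (Y : Subset n) (v : Fin n) : Subset n → Set where
    removed : Dominating G (Y - v) → DeleteStep Y v (Y - v)
    kept    : ¬ Dominating G (Y - v) → DeleteStep Y v Y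

  deleteStep-view : ∀ Y v → DeleteStep Y v (deleteStep Y v)
  deleteStep-view Y v = view (removable? Y v)
    where
    view : (d : Dec (Dominating G (Y - v))) → DeleteStep Y v (if does d then Y - v else Y)
    view (yes Y-v-dom) = removed Y-v-dom
    view (no ¬Y-v-dom) = kept ¬Y-v-dom

  deleteStep-⊆ : ∀ {Y v Z} → DeleteStep Y v Z → Z ⊆ Y
  deleteStep-⊆ {Y} {v} (removed _) = p─q⊆p Y ⁅ v ⁆
  deleteStep-⊆ (kept _)            = id

  deleteStep-keeps : ∀ {Y v Z u} → DeleteStep Y v Z → u ∈ Y → u ≢ v → u ∈ Z
  deleteStep-keeps (removed _) u∈Y u≢v = x∈p∧x≢y⇒x∈p-y u∈Y u≢v
  deleteStep-keeps (kept _)    u∈Y _   = u∈Y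

  deleteStep-dominating : ∀ {Y v Z} → DeleteStep Y v Z → Dominating G Y → Dominating G Z
  deleteStep-dominating (removed Y-v-dom) _     = Y-v-dom
  deleteStep-dominating (kept _)          Y-dom = Y-dom

  deleteStep-survivor : ∀ {Y v Z} → DeleteStep Y v Z → v ∈ Z → ∃ (PrivateNeighbour Y v)
  deleteStep-survivor {v = v} (removed _)     v∈Y-v = contradiction (x∈⁅x⁆ v) (x∈p─q⇒x∉q v∈Y-v)
  deleteStep-survivor {Y} {v} (kept ¬Y-v-dom) _     =
    ¬∀⟶∃¬ n _ (λ w → nonempty? ((Y - v) ∩ Γ⁺ G w)) ¬Y-v-dom

  reverseDelete-++ : ∀ Y xs ys →
                     reverseDelete G Y (xs ++ ys) ≡ reverseDelete G (reverseDelete G Y xs) ys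
  reverseDelete-++ Y []       ys = refl
  reverseDelete-++ Y (x ∷ xs) ys = reverseDelete-++ (deleteStep Y x) xs ys

  reverseDelete-⊆ : ∀ Y vs → reverseDelete G Y vs ⊆ Y
  reverseDelete-⊆ Y []       = id
  reverseDelete-⊆ Y (v ∷ vs) =
    deleteStep-⊆ (deleteStep-view Y v) ∘ reverseDelete-⊆ (deleteStep Y v) vs

  reverseDelete-++-⊆ : ∀ Y xs ys → reverseDelete G Y (xs ++ ys) ⊆ reverseDelete G Y xs
  reverseDelete-++-⊆ Y xs ys =
    reverseDelete-⊆ (reverseDelete G Y xs) ys ∘ subst (_ ∈_) (reverseDelete-++ Y xs ys)

  reverseDelete-keeps : ∀ Y vs {u} → u ∈ Y → u ∉ₗ vs → u ∈ reverseDelete G Y vs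
  reverseDelete-keeps Y []       u∈Y _     = u∈Y
  reverseDelete-keeps Y (v ∷ vs) u∈Y u∉vs =
    reverseDelete-keeps (deleteStep Y v) vs
      (deleteStep-keeps (deleteStep-view Y v) u∈Y (u∉vs ∘ here)) (u∉vs ∘ there)

  reverseDelete-dominating : ∀ Y vs → Dominating G Y → Dominating G (reverseDelete G Y vs)
  reverseDelete-dominating Y []       Y-dom = Y-dom
  reverseDelete-dominating Y (v ∷ vs) Y-dom =
    reverseDelete-dominating (deleteStep Y v) vs (deleteStep-dominating (deleteStep-view Y v) Y-dom)

  reverseDelete-survivor : ∀ Y vs {v} → v ∈ reverseDelete G Y vs → v ∈ₗ vs →
                           ∃₂ λ pre post → vs ≡ pre ++ v ∷ post
                                         × reverseDelete G Y vs ⊆ reverseDelete G Y pre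
                                         × ∃ (PrivateNeighbour (reverseDelete G Y pre) v)
  reverseDelete-survivor Y vs {v} v∈Y′ v∈vs with pre , post , refl ← ∈-∃++ v∈vs =
    pre , post , refl , reverseDelete-++-⊆ Y pre (v ∷ post) ,
    deleteStep-survivor (deleteStep-view Z v)
      (reverseDelete-⊆ (deleteStep Z v) post (subst (v ∈_) (reverseDelete-++ Y pre (v ∷ post)) v∈Y′))
    where Z = reverseDelete G Y pre

  module _ {c : Fin n → ℚ} (R : PrimalDualRun G c) where
    open PrimalDualRun R

    X-grows : ∀ {i} → i < T → X i ⊆ X (suc i)
    X-grows {i} i<T x∈Xi = Equivalence.from (X-step i i<T _) (inj₁ x∈Xi)

    X-mono : ∀ {i j} → i ≤′ j → j ≤ T → X i ⊆ X j
    X-mono ≤′-refl          _     = id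
    X-mono (≤′-step i≤′j) 1+j≤T = X-grows 1+j≤T ∘ X-mono i≤′j (<⇒≤ 1+j≤T)

    AddedNoLaterThan : Fin n → Fin n → Set
    AddedNoLaterThan u v = ∀ j → v ∈ X j → u ∈ X j

    module _ (O : AdditionOrder G R) where
      open AdditionOrder O

      Y : Subset n
      Y = outputY G R O

      Y-dominating : Dominating G Y
      Y-dominating = reverseDelete-dominating (X T) (reverse ord) (Aset-empty⇒dominating stop)

      ∈Y⇒∈reverse-ord : ∀ {v} → v ∈ Y → v ∈ₗ reverse ord
      ∈Y⇒∈reverse-ord {v} v∈Y =
        ∈-reverse⁺ (Equivalence.to (covers v) (reverseDelete-⊆ (X T) (reverse ord) v∈Y))

      examined-earlier⇒added-later : ∀ {pre v post u} → reverse ord ≡ pre ++ v ∷ post → u ∈ₗ pre →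
                                     AddedNoLaterThan v u
      examined-earlier⇒added-later {pre} {post = post} split u∈pre =
        indexSorted-++-∷ {R = AddedNoLaterThan} (reverse post)
          (subst (IndexSorted AddedNoLaterThan) (reverse≡++-∷ ord pre split) consistent)
          (∈-reverse⁺ u∈pre)

      record SurvivorWitness (i : ℕ) (v : Fin n) : Set where
        field
          neighbour   : Fin n
          neighbour∈A : neighbour ∈ Aset G (X i)
          stage       : Subset n
          Y⊆stage     : Y ⊆ stage
          isPrivate   : PrivateNeighbour stage v neighbour
      open SurvivorWitness

      survivorWitness : ∀ {i v} → i ≤ T → v ∈ Y ─ X i → SurvivorWitness i v
      survivorWitness {i} i≤T v∈Y─Xi
        with v∈Y ← p─q⊆p Y (X i) v∈Y─Xi
        with pre , post , split , Y⊆Z , w , private-w ←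
               reverseDelete-survivor (X T) (reverse ord) v∈Y (∈Y⇒∈reverse-ord v∈Y)
        = record { neighbour = w ; neighbour∈A = ∈Aset⁺ Xi∩Γ⁺w-empty
                 ; stage = reverseDelete G (X T) pre ; Y⊆stage = Y⊆Z ; isPrivate = private-w }
        where
        v∉Xi = x∈p─q⇒x∉q v∈Y─Xi

        Xi∩Γ⁺w-empty : Empty (X i ∩ Γ⁺ G w)
        Xi∩Γ⁺w-empty (u , u∈Xi∩Γ⁺w)
          with u∈Xi , u∈Γ⁺w ← x∈p∩q⁻ (X i) (Γ⁺ G w) u∈Xi∩Γ⁺w
          with _∈?_ _≟_ u pre
        ... | yes u∈pre = v∉Xi (examined-earlier⇒added-later split u∈pre i u∈Xi)
        ... | no  u∉pre = v∉Xi (subst (_∈ X i) u≡v u∈Xi)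
          where
          u∈Z = reverseDelete-keeps (X T) pre (X-mono (≤⇒≤′ i≤T) ≤-refl u∈Xi) u∉pre
          u≡v = privateNeighbour-dominator private-w u∈Z u∈Γ⁺w

      survivorWitness-injective : ∀ {i v v′} (p : SurvivorWitness i v) (q : SurvivorWitness i v′) →
                                  neighbour p ≡ neighbour q → v ≡ v′
      survivorWitness-injective p q w≡w′ =
        privateNeighbour-unique Y-dominating (Y⊆stage p) (Y⊆stage q) (isPrivate p)
          (subst (PrivateNeighbour (stage q) _) (sym w≡w′) (isPrivate q))

-- The cost hypothesis is unused: only the addition order and the stopping rule matter.
lemma4 : ∀ (n : ℕ) (G : Graph n) (c : Fin n → ℚ) → (∀ v → 0ℚ Q.≤ c v) →
             (R : PrimalDualRun G c) (O : AdditionOrder G R) →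
             ∀ (i : ℕ) → i ≤ PrimalDualRun.T R →
             ∣ outputY G R O ─ PrimalDualRun.X R i ∣ ≤ ∣ Aset G (PrimalDualRun.X R i) ∣
lemma4 n G c _ R O i i≤T =
  injection⇒∣p∣≤∣q∣ (neighbour ∘ witness) (neighbour∈A ∘ witness)
                    (λ v∈ v′∈ → survivorWitness-injective G R O (witness v∈) (witness v′∈))
  where
  open SurvivorWitness
  witness : ∀ {v} → v ∈ outputY G R O ─ PrimalDualRun.X R i → SurvivorWitness G R O i v
  witness = survivorWitness G R O i≤T
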